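{- Let $G$ be a finite abelian group and let $f$ be an automorphism of the monoid $\mathcal{P}_{0}(G)$ with pullback $g$. If $H$ is a subgroup of $G$, then $f(H)=g[H]=\{g(h): h\in H\}$.
   Context: For an additively written finite abelian group $G$, $\mathcal{P}_{0}(G)$ denotes the reduced power monoid of $G$: the set of all subsets of $G$ containing $0$, with setwise addition $X+Y=\{x+y : x\in X, y\in Y\}$ and identity $\{0\}$. Every automorphism $f$ of $\mathcal{P}_{0}(G)$ maps $2$-element sets to $2$-element sets; the pullback of $f$ is the bijection $g:G\to G$ defined by $g(0)=0$ and, for nonzero $a\in G$, by $f(\{0,a\})=\{0,g(a)\}$. -}

module Defs where

open import Data.Nat using (ℕ)
open import Data.Fin using (Fin)
open import Data.Fin.Properties using () renaming (_≟_ to _≟ᶠ_)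
open import Data.Bool using (Bool; true; false; _∧_; _∨_)
open import Data.List using (List; map; cartesianProduct)
open import Data.Bool.ListAction using (any)
open import Data.List.Base using (allFin)
open import Data.Product using (Σ; _×_; _,_; proj₁; proj₂)
open import Function.Bundles using (_↔_; Inverse)
open import Relation.Binary.PropositionalEquality using (_≡_; _≢_; cong; sym; trans)
open import Relation.Binary.Definitions using (DecidableEquality)
open import Relation.Nullary.Decidable using (map′; ⌊_⌋)
open import Algebra.Structures using (IsAbelianGroup)

record FiniteAbelianGroup : Set₁ where
  infixl 6 _+_
  field
    Carrier        : Set
    _+_            : Carrier → Carrier → Carrier
    0#             : Carrier
    -_             : Carrier → Carrier
    isAbelianGroup : IsAbelianGroup _≡_ _+_ 0# -_
    size           : ℕ
    enum           : Carrier ↔ Fin size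

  elements : List Carrier
  elements = map (Inverse.from enum) (allFin size)

  _≟_ : DecidableEquality Carrier
  x ≟ y = map′ inj (cong (Inverse.to enum)) (Inverse.to enum x ≟ᶠ Inverse.to enum y)
    where
    inj : Inverse.to enum x ≡ Inverse.to enum y → x ≡ y
    inj e = trans (sym (Inverse.inverseʳ enum _≡_.refl))
                  (trans (cong (Inverse.from enum) e) (Inverse.inverseʳ enum _≡_.refl))

  -- subsets of G (decidable, G being finite), compared extensionally
  Subset : Set
  Subset = Carrier → Bool

  _≐_ : Subset → Subset → Set
  X ≐ Y = ∀ z → X z ≡ Y z

  _⊕_ : Subset → Subset → Subset
  (X ⊕ Y) z = any (λ p → X (proj₁ p) ∧ Y (proj₂ p) ∧ ⌊ (proj₁ p + proj₂ p) ≟ z ⌋)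
                  (cartesianProduct elements elements)

  pair0 : Carrier → Subset
  pair0 a z = ⌊ z ≟ 0# ⌋ ∨ ⌊ z ≟ a ⌋

  image : (Carrier → Carrier) → Subset → Subset
  image g X z = any (λ x → X x ∧ ⌊ g x ≟ z ⌋) elements

  record IsSubgroup (H : Subset) : Set where
    field
      has-0 : H 0# ≡ true
      +-closed : ∀ x y → H x ≡ true → H y ≡ true → H (x + y) ≡ true
      neg-closed : ∀ x → H x ≡ true → H (- x) ≡ true

  zeroSet : Subset
  zeroSet z = ⌊ z ≟ 0# ⌋

  -- P₀(G) is the set of subsets X with X 0# ≡ true.  A map f on subsets is
  -- (the underlying map of) an automorphism of the monoid P₀(G) if it maps
  -- P₀(G) to itself, respects extensional equality, is a monoid
  -- homomorphism on P₀(G), and is bijective on P₀(G).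
  -- (Values of f outside P₀(G) are irrelevant.)
  record IsAutP₀ (f : Subset → Subset) : Set where
    field
      into       : ∀ X → X 0# ≡ true → f X 0# ≡ true
      f-cong     : ∀ X Y → X ≐ Y → f X ≐ f Y
      f-hom      : ∀ X Y → X 0# ≡ true → Y 0# ≡ true → f (X ⊕ Y) ≐ (f X ⊕ f Y)
      f-id       : f zeroSet ≐ zeroSet
      injective  : ∀ X Y → X 0# ≡ true → Y 0# ≡ true → f X ≐ f Y → X ≐ Y
      surjective : ∀ Y → Y 0# ≡ true → Σ Subset (λ X → (X 0# ≡ true) × (f X ≐ Y))

  IsPullback : (Subset → Subset) → (Carrier → Carrier) → Set
  IsPullback f g = (g 0# ≡ 0#) × (∀ a → a ≢ 0# → f (pair0 a) ≐ pair0 (g a))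

{-# OPTIONS --safe #-}
-- An element a lies in a submonoid Z of G exactly when {0,a} + Z = Z.  The automorphism f
-- preserves this equation, sends {0,a} to {0, g a} and sends submonoids to submonoids (they
-- are the idempotents of P₀(G)), so a ∈ H ⇔ g a ∈ f(H) for every submonoid H.  Since g is
-- injective on the finite set G it is onto, and therefore f(H) = g[H].
module Submission where

open import Defs

open import Level using (0ℓ)
open import Data.Nat using (suc)
open import Data.Nat.Properties using (1+n≰n)
open import Data.Fin using (Fin; punchOut)
open import Data.Fin.Properties using (any?; punchOut-injective; injective⇒≤)
  renaming (_≟_ to _≟ᶠ_)
open import Data.Bool using (true; T)
open import Data.Bool.Properties using (T-≡; T-∧; T-∨; ∨-idem; ⇔→≡)
open import Data.List using (cartesianProduct)
import Data.List.Membership.Propositional as List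
open import Data.List.Membership.Propositional.Properties
  using (∈-map⁺; ∈-cartesianProduct⁺; ∈-allFin)
open import Data.List.Relation.Unary.Any using (satisfied)
open import Data.List.Relation.Unary.Any.Properties using (any⁺; any⁻)
open import Data.Product using (∃; ∃₂; _×_; _,_; proj₁; proj₂)
open import Data.Sum using (_⊎_; inj₁; inj₂)
open import Function using (_∘_)
open import Function.Bundles using (_↔_; _⇔_; mk⇔; Inverse; Injection; Equivalence)
open import Function.Definitions using (Injective)
open import Function.Properties.Equivalence using (⇔-setoid)
open import Function.Properties.Inverse using (↔-sym; ↔⇒↣)
open import Relation.Nullary using (yes; no; contradiction)
open import Relation.Nullary.Decidable using (⌊_⌋; toWitness; fromWitness)
open import Relation.Binary.PropositionalEquality using (_≡_; _≢_; refl; sym; trans; cong; subst; module ≡-Reasoning)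
import Relation.Binary.Reasoning.Setoid as SetoidReasoning
open import Algebra.Structures using (IsAbelianGroup)

Fin-injective⇒surjective : ∀ {n} {h : Fin n → Fin n} → Injective _≡_ _≡_ h →
                           ∀ y → ∃ λ x → h x ≡ y
Fin-injective⇒surjective {suc n} {h} h-injective y with any? (λ x → h x ≟ᶠ y)
... | yes hit = hit
... | no miss = contradiction (injective⇒≤ punchOut∘h-injective) 1+n≰n
  where
  y≢h : ∀ x → y ≢ h x
  y≢h x y≡hx = miss (x , sym y≡hx)

  punchOut∘h-injective : Injective _≡_ _≡_ (λ x → punchOut (y≢h x))
  punchOut∘h-injective eq = h-injective (punchOut-injective (y≢h _) (y≢h _) eq)

injective⇒surjective : ∀ {A : Set} {n} → A ↔ Fin n → {h : A → A} → Injective _≡_ _≡_ h →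
                       ∀ y → ∃ λ x → h x ≡ y
injective⇒surjective A↔Fin {h} h-injective y =
  let x , hx≡y = Fin-injective⇒surjective (from-injective ∘ h-injective ∘ to-injective) (to y)
  in from x , to-injective hx≡y
  where
  open Inverse A↔Fin using (to; from)

  to-injective : Injective _≡_ _≡_ to
  to-injective = Injection.injective (↔⇒↣ A↔Fin)

  from-injective : Injective _≡_ _≡_ from
  from-injective = Injection.injective (↔⇒↣ (↔-sym A↔Fin))

module SubsetAlgebra (G : FiniteAbelianGroup) where
  open FiniteAbelianGroup G
  open IsAbelianGroup isAbelianGroup using (identityˡ; identityʳ)

  infix 4 _∈_ _⊆_

  -- A record rather than T (X x), so that x and X can be inferred from a membership proof.
  record _∈_ (x : Carrier) (X : Subset) : Set where
    constructor mk∈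
    field holds : X x ≡ true
  open _∈_ public

  _⊆_ : Subset → Subset → Set
  X ⊆ Y = ∀ {x} → x ∈ X → x ∈ Y

  ∈⇒T : ∀ {x X} → x ∈ X → T (X x)
  ∈⇒T (mk∈ Xx) = Equivalence.from T-≡ Xx

  T⇒∈ : ∀ {x X} → T (X x) → x ∈ X
  T⇒∈ Xx = mk∈ (Equivalence.to T-≡ Xx)

  ∈-resp-≐ : ∀ {x X Y} → X ≐ Y → x ∈ X → x ∈ Y
  ∈-resp-≐ X≐Y (mk∈ Xx) = mk∈ (trans (sym (X≐Y _)) Xx)

  ⊆-antisym : ∀ {X Y} → X ⊆ Y → Y ⊆ X → X ≐ Y
  ⊆-antisym X⊆Y Y⊆X z = ⇔→≡ (mk⇔ (holds ∘ X⊆Y ∘ mk∈) (holds ∘ Y⊆X ∘ mk∈))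

  ≐-respˡ-⇔ : ∀ {X X' Y} → X ≐ X' → (X ≐ Y) ⇔ (X' ≐ Y)
  ≐-respˡ-⇔ X≐X' = mk⇔ (λ X≐Y z → trans (sym (X≐X' z)) (X≐Y z))
                       (λ X'≐Y z → trans (X≐X' z) (X'≐Y z))

  ∈-elements : ∀ x → x List.∈ elements
  ∈-elements x = subst (List._∈ elements) (Inverse.strictlyInverseʳ enum x)
                       (∈-map⁺ (Inverse.from enum) (∈-allFin (Inverse.to enum x)))

  ∈-⊕⁺ : ∀ {X Y x y} → x ∈ X → y ∈ Y → x + y ∈ X ⊕ Y
  ∈-⊕⁺ {x = x} {y} x∈X y∈Y = T⇒∈ (any⁺ _
    (List.lose (∈-cartesianProduct⁺ (∈-elements x) (∈-elements y))
               (Equivalence.from T-∧ (∈⇒T x∈X , Equivalence.from T-∧ (∈⇒T y∈Y , fromWitness refl)))))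

  ∈-⊕⁻ : ∀ {X Y z} → z ∈ X ⊕ Y → ∃₂ λ x y → x ∈ X × y ∈ Y × x + y ≡ z
  ∈-⊕⁻ z∈X⊕Y
    with (x , y) , hit ← satisfied (any⁻ _ (cartesianProduct elements elements) (∈⇒T z∈X⊕Y))
    with Xx , rest ← Equivalence.to T-∧ hit
    with Yy , sum≡z ← Equivalence.to T-∧ rest
    = x , y , T⇒∈ Xx , T⇒∈ Yy , toWitness sum≡z

  0∈-⊕ : ∀ {X Y} → 0# ∈ X → 0# ∈ Y → 0# ∈ X ⊕ Y
  0∈-⊕ {X} {Y} 0∈X 0∈Y = subst (_∈ X ⊕ Y) (identityʳ 0#) (∈-⊕⁺ 0∈X 0∈Y)

  ⊕-congˡ : ∀ {X X' Y} → X ≐ X' → (X ⊕ Y) ≐ (X' ⊕ Y)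
  ⊕-congˡ {Y = Y} X≐X' = ⊆-antisym (along X≐X') (along (sym ∘ X≐X'))
    where
    along : ∀ {A B} → A ≐ B → A ⊕ Y ⊆ B ⊕ Y
    along A≐B z∈A⊕Y with x , y , x∈A , y∈Y , refl ← ∈-⊕⁻ z∈A⊕Y = ∈-⊕⁺ (∈-resp-≐ A≐B x∈A) y∈Y

  ∈-image⁺ : ∀ {h X x} → x ∈ X → h x ∈ image h X
  ∈-image⁺ {x = x} x∈X =
    T⇒∈ (any⁺ _ (List.lose (∈-elements x) (Equivalence.from T-∧ (∈⇒T x∈X , fromWitness refl))))

  ∈-image⁻ : ∀ {h X z} → z ∈ image h X → ∃ λ x → x ∈ X × h x ≡ z
  ∈-image⁻ z∈hX
    with x , hit ← satisfied (any⁻ _ elements (∈⇒T z∈hX))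
    with Xx , hx≡z ← Equivalence.to T-∧ hit
    = x , T⇒∈ Xx , toWitness hx≡z

  0∈pair0 : ∀ {a} → 0# ∈ pair0 a
  0∈pair0 {a} = T⇒∈ (Equivalence.from (T-∨ {⌊ 0# ≟ 0# ⌋} {⌊ 0# ≟ a ⌋}) (inj₁ (fromWitness refl)))

  a∈pair0 : ∀ {a} → a ∈ pair0 a
  a∈pair0 {a} = T⇒∈ (Equivalence.from (T-∨ {⌊ a ≟ 0# ⌋} {⌊ a ≟ a ⌋}) (inj₂ (fromWitness refl)))

  ∈-pair0⁻ : ∀ {a x} → x ∈ pair0 a → x ≡ 0# ⊎ x ≡ a
  ∈-pair0⁻ {a} {x} x∈pair0 with Equivalence.to (T-∨ {⌊ x ≟ 0# ⌋} {⌊ x ≟ a ⌋}) (∈⇒T x∈pair0)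
  ... | inj₁ x≡0 = inj₁ (toWitness x≡0)
  ... | inj₂ x≡a = inj₂ (toWitness x≡a)

  pair0-⊆ : ∀ {a Z} → 0# ∈ Z → a ∈ Z → pair0 a ⊆ Z
  pair0-⊆ 0∈Z a∈Z x∈pair0 with ∈-pair0⁻ x∈pair0
  ... | inj₁ refl = 0∈Z
  ... | inj₂ refl = a∈Z

  pair0-injective : ∀ {a b} → pair0 a ≐ pair0 b → a ≡ b
  pair0-injective pair0a≐pair0b
    with ∈-pair0⁻ (∈-resp-≐ pair0a≐pair0b a∈pair0) | ∈-pair0⁻ (∈-resp-≐ (sym ∘ pair0a≐pair0b) a∈pair0)
  ... | inj₂ a≡b | _        = a≡b
  ... | inj₁ _   | inj₂ b≡a = sym b≡a
  ... | inj₁ a≡0 | inj₁ b≡0 = trans a≡0 (sym b≡0)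

  pair0-0≐zeroSet : pair0 0# ≐ zeroSet
  pair0-0≐zeroSet z = ∨-idem (zeroSet z)

  record IsSubmonoid (Z : Subset) : Set where
    field
      0∈       : 0# ∈ Z
      +-closed : ∀ {x y} → x ∈ Z → y ∈ Z → x + y ∈ Z

  subgroup⇒submonoid : ∀ {H} → IsSubgroup H → IsSubmonoid H
  subgroup⇒submonoid H-subgroup = record
    { 0∈       = mk∈ has-0
    ; +-closed = λ (mk∈ Hx) (mk∈ Hy) → mk∈ (+-closed _ _ Hx Hy)
    }
    where open IsSubgroup H-subgroup

  ⊕-absorbˡ : ∀ {X Z} → IsSubmonoid Z → 0# ∈ X → X ⊆ Z → (X ⊕ Z) ≐ Z
  ⊕-absorbˡ {X} {Z} Z-submonoid 0∈X X⊆Z = ⊆-antisym X⊕Z⊆Z Z⊆X⊕Z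
    where
    open IsSubmonoid Z-submonoid

    X⊕Z⊆Z : X ⊕ Z ⊆ Z
    X⊕Z⊆Z z∈X⊕Z with x , y , x∈X , y∈Z , refl ← ∈-⊕⁻ z∈X⊕Z = +-closed (X⊆Z x∈X) y∈Z

    Z⊆X⊕Z : Z ⊆ X ⊕ Z
    Z⊆X⊕Z {z} z∈Z = subst (_∈ X ⊕ Z) (identityˡ z) (∈-⊕⁺ 0∈X z∈Z)

  ⊕-idem⇒submonoid : ∀ {Z} → 0# ∈ Z → (Z ⊕ Z) ≐ Z → IsSubmonoid Z
  ⊕-idem⇒submonoid 0∈Z Z⊕Z≐Z = record
    { 0∈       = 0∈Z
    ; +-closed = λ x∈Z y∈Z → ∈-resp-≐ Z⊕Z≐Z (∈-⊕⁺ x∈Z y∈Z)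
    }

  ∈⇔pair0-⊕-absorbed : ∀ {Z a} → IsSubmonoid Z → a ∈ Z ⇔ ((pair0 a ⊕ Z) ≐ Z)
  ∈⇔pair0-⊕-absorbed {Z} {a} Z-submonoid = mk⇔
    (λ a∈Z → ⊕-absorbˡ Z-submonoid 0∈pair0 (pair0-⊆ 0∈ a∈Z))
    (λ absorbed → ∈-resp-≐ absorbed (subst (_∈ pair0 a ⊕ Z) (identityʳ a) (∈-⊕⁺ a∈pair0 0∈)))
    where open IsSubmonoid Z-submonoid

module Automorphism (G : FiniteAbelianGroup) where
  open FiniteAbelianGroup G
  open SubsetAlgebra G

  module _ {f : Subset → Subset} {g : Carrier → Carrier}
           (f-aut : IsAutP₀ f) (g-pullback : IsPullback f g) where
    open IsAutP₀ f-aut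

    f-pair0 : ∀ a → f (pair0 a) ≐ pair0 (g a)
    f-pair0 a with a ≟ 0#
    ... | no a≢0   = proj₂ g-pullback a a≢0
    ... | yes refl = λ z → begin
      f (pair0 0#) z   ≡⟨ f-cong _ _ pair0-0≐zeroSet z ⟩
      f zeroSet z      ≡⟨ f-id z ⟩
      zeroSet z        ≡⟨ pair0-0≐zeroSet z ⟨
      pair0 0# z       ≡⟨ cong (λ c → pair0 c z) (proj₁ g-pullback) ⟨
      pair0 (g 0#) z   ∎
      where open ≡-Reasoning

    f-≐⇔≐ : ∀ {X Y} → 0# ∈ X → 0# ∈ Y → (f X ≐ f Y) ⇔ (X ≐ Y)
    f-≐⇔≐ 0∈X 0∈Y = mk⇔ (injective _ _ (holds 0∈X) (holds 0∈Y)) (f-cong _ _)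

    f-submonoid : ∀ {H} → IsSubmonoid H → IsSubmonoid (f H)
    f-submonoid {H} H-submonoid = ⊕-idem⇒submonoid (mk∈ (into H (holds 0∈)))
      (λ z → trans (sym (f-hom H H (holds 0∈) (holds 0∈) z))
                   (f-cong _ _ (⊕-absorbˡ H-submonoid 0∈ (λ x∈H → x∈H)) z))
      where open IsSubmonoid H-submonoid

    g-injective : Injective _≡_ _≡_ g
    g-injective {a} {b} ga≡gb = pair0-injective
      (Equivalence.to (f-≐⇔≐ 0∈pair0 0∈pair0)
        (λ z → trans (f-pair0 a z) (trans (cong (λ c → pair0 c z) ga≡gb) (sym (f-pair0 b z)))))

    g-surjective : ∀ y → ∃ λ x → g x ≡ y
    g-surjective = injective⇒surjective enum g-injective

    ∈⇔g∈f : ∀ {H a} → IsSubmonoid H → a ∈ H ⇔ g a ∈ f H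
    ∈⇔g∈f {H} {a} H-submonoid = begin
      a ∈ H                     ≈⟨ ∈⇔pair0-⊕-absorbed H-submonoid ⟩
      (pair0 a ⊕ H) ≐ H         ≈⟨ f-≐⇔≐ (0∈-⊕ 0∈pair0 0∈) 0∈ ⟨
      f (pair0 a ⊕ H) ≐ f H     ≈⟨ ≐-respˡ-⇔ f-pair0-⊕ ⟩
      (pair0 (g a) ⊕ f H) ≐ f H ≈⟨ ∈⇔pair0-⊕-absorbed (f-submonoid H-submonoid) ⟨
      g a ∈ f H                 ∎
      where
      open IsSubmonoid H-submonoid
      open SetoidReasoning (⇔-setoid 0ℓ)

      f-pair0-⊕ : f (pair0 a ⊕ H) ≐ (pair0 (g a) ⊕ f H)
      f-pair0-⊕ z = trans (f-hom _ _ (holds 0∈pair0) (holds 0∈) z) (⊕-congˡ (f-pair0 a) z)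

    f≐image : ∀ {H} → IsSubmonoid H → f H ≐ image g H
    f≐image {H} H-submonoid = ⊆-antisym fH⊆gH gH⊆fH
      where
      fH⊆gH : f H ⊆ image g H
      fH⊆gH {z} z∈fH with a , refl ← g-surjective z =
        ∈-image⁺ (Equivalence.from (∈⇔g∈f H-submonoid) z∈fH)

      gH⊆fH : image g H ⊆ f H
      gH⊆fH z∈gH with x , x∈H , refl ← ∈-image⁻ z∈gH =
        Equivalence.to (∈⇔g∈f H-submonoid) x∈H

open FiniteAbelianGroup using (Subset; IsAutP₀; IsPullback; IsSubgroup; image; _≐_)

lemma2p4 : (G : FiniteAbelianGroup) (f : Subset G → Subset G) (g : FiniteAbelianGroup.Carrier G → FiniteAbelianGroup.Carrier G) →
    IsAutP₀ G f → IsPullback G f g → (H : Subset G) → IsSubgroup G H →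
    _≐_ G (f H) (image G g H)
lemma2p4 G f g f-aut g-pullback H H-subgroup =
  Automorphism.f≐image G f-aut g-pullback (SubsetAlgebra.subgroup⇒submonoid G H-subgroup)
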